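{- Let $(g(x),f(x))$ be a Riordan array and let $\phi(x)=\mathrm{Rev}\left(\frac{x^2}{f(x)}\right)$. Then the horizontal half $H$ of $(g(x),f(x))$ is the Riordan array $$H=\left(\frac{x\phi'(x)g(\phi(x))}{\phi(x)},f(\phi(x))\right)=\left(\frac{\phi(x)\phi'(x)g(\phi(x))}{f(\phi(x))},f(\phi(x))\right).$$
   Context: All power series are formal power series with complex coefficients. A Riordan array is a pair $(g(x),f(x))$ of power series with $g(0)\neq 0$, $f(0)=0$, $f'(0)\neq 0$; it is identified with the infinite lower triangular matrix $(t_{n,k})_{n,k\ge 0}$, $t_{n,k}=[x^n]g(x)f(x)^k$. The product is $(g,f)\cdot(u,v)=(g(x)u(f(x)),v(f(x)))$, which corresponds to matrix multiplication. $\mathrm{Rev}(h)$ denotes the compositional inverse of a power series $h$ with $h(0)=0$, $h'(0)\ne0$. The horizontal half of a Riordan array with matrix $(t_{n,k})$ is the matrix $H$ whose $(n,k)$ entry is $t_{2n,n+k}$. -}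

module Defs where

open import Level using (_⊔_)
open import Data.Nat using (ℕ; zero; suc; _∸_)
open import Data.Product using (Σ; _×_)
open import Relation.Nullary using (¬_)
open import Algebra.Bundles using (CommutativeRing)

IsField : ∀ {c ℓ} → CommutativeRing c ℓ → Set (c ⊔ ℓ)
IsField R = ¬ (1# ≈ 0#) × (∀ a → ¬ (a ≈ 0#) → Σ Carrier λ b → a * b ≈ 1#)
  where open CommutativeRing R

module FPS {c ℓ} (R : CommutativeRing c ℓ) where
  open CommutativeRing R using (Carrier; _+_; _*_; 0#; 1#)
  open CommutativeRing R public using (_≈_)

  nat : ℕ → Carrier
  nat zero = 0#
  nat (suc n) = 1# + nat n

  CharZero : Set ℓ
  CharZero = ∀ n → ¬ (nat (suc n) ≈ 0#)

  PS : Set c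
  PS = ℕ → Carrier

  infix 4 _≋_
  _≋_ : PS → PS → Set ℓ
  a ≋ b = ∀ n → a n ≈ b n

  sumUpTo : (ℕ → Carrier) → ℕ → Carrier
  sumUpTo h zero = h zero
  sumUpTo h (suc n) = sumUpTo h n + h (suc n)

  one : PS
  one zero = 1#
  one (suc _) = 0#

  X : PS
  X (suc zero) = 1#
  X _ = 0#

  infixl 7 _⊛_
  _⊛_ : PS → PS → PS
  (a ⊛ b) n = sumUpTo (λ i → a i * b (n ∸ i)) n

  pow : PS → ℕ → PS
  pow a zero = one
  pow a (suc k) = a ⊛ pow a k

  -- composition g(h(x)); meaningful when h(0) = 0:
  -- [x^n] g(h) = Σ_{k=0}^{n} g_k [x^n] h^k
  _∘ₚ_ : PS → PS → PS
  (g ∘ₚ h) n = sumUpTo (λ k → g k * pow h k n) n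

  deriv : PS → PS
  deriv a n = nat (suc n) * a (suc n)

  IsRiordan : PS → PS → Set ℓ
  IsRiordan g f = ¬ (g 0 ≈ 0#) × (f 0 ≈ 0#) × ¬ (f 1 ≈ 0#)

  riordanEntry : PS → PS → ℕ → ℕ → Carrier
  riordanEntry g f n k = (g ⊛ pow f k) n

  IsRev : PS → PS → Set ℓ
  IsRev h φ = (φ 0 ≈ 0#) × (h ∘ₚ φ ≋ X)

-- Write f = x·w, x²/f = x·v and φ = x·u.  Then v·w = 1, and q(φ) = x gives u·y = 1 for y = v(φ),
-- hence w(φ) = u and f(φ) = x·u²; also G₁ = φ′·g(φ)·y.  Both entries t_{2n,n+k} and [xⁿ] G₁ f(φ)ᵏ
-- reduce to [x^(n−k)] of a power series, and Lagrange inversion for φ = x·w(φ) identifies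
-- [xᵉ] (xφ′/φ)·u²ᵏ·g(φ) with [xᵉ] g·wᵉ⁺²ᵏ.  The inversion formula itself rests on the fact that the
-- residue of φ′/φ^(r+1) is 1 for r = 0 and 0 otherwise, which needs division by r (characteristic zero).

module Submission where

open import Defs
open import Level using (Level; _⊔_)
open import Data.Product using (_×_; _,_; proj₁; proj₂)
open import Algebra.Bundles using (CommutativeRing)
open import Relation.Nullary using (¬_; yes; no)
import Data.Nat as ℕ
open ℕ using (ℕ; zero; suc; _∸_; _≤_; _<_; _≤?_; z≤n; s≤s)
import Data.Nat.Properties as ℕₚ
open import Data.Nat.Induction using (<-rec)
open import Data.Nat.Tactic.RingSolver using (solve-∀)
import Relation.Binary.PropositionalEquality as ≡
import Algebra.Solver.Ring.NaturalCoefficients.Default as NaturalCoefficientSolver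
import Relation.Binary.Reasoning.Setoid as SetoidReasoning

module Series {c ℓ} (R : CommutativeRing c ℓ) where
  open CommutativeRing R
  open FPS R hiding (_≈_)
  open NaturalCoefficientSolver commutativeSemiring using (solve; _:+_; _:*_; _:=_)
  module ≈-Reasoning = SetoidReasoning setoid

  sumUpTo-cong : ∀ {f g : ℕ → Carrier} n → (∀ i → i ≤ n → f i ≈ g i) → sumUpTo f n ≈ sumUpTo g n
  sumUpTo-cong zero f≈g = f≈g 0 z≤n
  sumUpTo-cong (suc n) f≈g = +-cong (sumUpTo-cong n (λ i i≤n → f≈g i (ℕₚ.m≤n⇒m≤1+n i≤n))) (f≈g (suc n) ℕₚ.≤-refl)

  sumUpTo-+ : ∀ (f g : ℕ → Carrier) n → sumUpTo (λ i → f i + g i) n ≈ sumUpTo f n + sumUpTo g n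
  sumUpTo-+ f g zero = refl
  sumUpTo-+ f g (suc n) = trans (+-cong (sumUpTo-+ f g n) refl)
    (solve 4 (λ a b c d → (a :+ b) :+ (c :+ d) := (a :+ c) :+ (b :+ d)) refl _ _ _ _)

  sumUpTo-*ˡ : ∀ a (f : ℕ → Carrier) n → sumUpTo (λ i → a * f i) n ≈ a * sumUpTo f n
  sumUpTo-*ˡ a f zero = refl
  sumUpTo-*ˡ a f (suc n) = trans (+-cong (sumUpTo-*ˡ a f n) refl) (sym (distribˡ a _ _))

  sumUpTo-zero : ∀ (f : ℕ → Carrier) n → (∀ i → i ≤ n → f i ≈ 0#) → sumUpTo f n ≈ 0#
  sumUpTo-zero f zero f≈0 = f≈0 0 z≤n
  sumUpTo-zero f (suc n) f≈0 =
    trans (+-cong (sumUpTo-zero f n (λ i i≤n → f≈0 i (ℕₚ.m≤n⇒m≤1+n i≤n))) (f≈0 (suc n) ℕₚ.≤-refl)) (+-identityˡ 0#)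

  sumUpTo-suc : ∀ (f : ℕ → Carrier) n → sumUpTo f (suc n) ≈ f 0 + sumUpTo (λ i → f (suc i)) n
  sumUpTo-suc f zero = refl
  sumUpTo-suc f (suc n) = trans (+-cong (sumUpTo-suc f n) refl) (+-assoc _ _ _)

  sumUpTo-swap : ∀ (f : ℕ → ℕ → Carrier) m n →
    sumUpTo (λ k → sumUpTo (f k) n) m ≈ sumUpTo (λ i → sumUpTo (λ k → f k i) m) n
  sumUpTo-swap f zero n = refl
  sumUpTo-swap f (suc m) n = trans (+-cong (sumUpTo-swap f m n) refl) (sym (sumUpTo-+ _ _ n))

  sumUpTo-truncate : ∀ (f : ℕ → Carrier) m n → m ≤ n → (∀ k → m < k → f k ≈ 0#) → sumUpTo f n ≈ sumUpTo f m
  sumUpTo-truncate f zero zero _ _ = refl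
  sumUpTo-truncate f m (suc n) m≤1+n f≈0 with m ≤? n
  ... | yes m≤n = trans (+-cong (sumUpTo-truncate f m n m≤n f≈0) (f≈0 (suc n) (s≤s m≤n))) (+-identityʳ _)
  ... | no m≰n rewrite ℕₚ.≤-antisym m≤1+n (ℕₚ.≰⇒> m≰n) = refl

  sumUpTo-last : ∀ (f : ℕ → Carrier) n → (∀ i → i < n → f i ≈ 0#) → sumUpTo f n ≈ f n
  sumUpTo-last f zero _ = refl
  sumUpTo-last f (suc n) f≈0 = trans (+-cong (sumUpTo-zero f n (λ i i≤n → f≈0 i (s≤s i≤n))) refl) (+-identityˡ _)

  infixl 6 _+ₚ_
  _+ₚ_ : PS → PS → PS
  (a +ₚ b) n = a n + b n

  -ₚ_ : PS → PS
  (-ₚ a) n = - a n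

  0ₚ : PS
  0ₚ _ = 0#

  const : Carrier → PS
  const a zero = a
  const a (suc _) = 0#

  shift : PS → PS
  shift a n = a (suc n)

  ⊛-cong : ∀ {a a′ b b′} → a ≋ a′ → b ≋ b′ → a ⊛ b ≋ a′ ⊛ b′
  ⊛-cong a≋a′ b≋b′ n = sumUpTo-cong n (λ i _ → *-cong (a≋a′ i) (b≋b′ (n ∸ i)))

  ⊛-congˡ : ∀ {a a′} b → a ≋ a′ → a ⊛ b ≋ a′ ⊛ b
  ⊛-congˡ b a≋a′ = ⊛-cong {b = b} a≋a′ (λ _ → refl)

  ⊛-congʳ : ∀ a {b b′} → b ≋ b′ → a ⊛ b ≋ a ⊛ b′
  ⊛-congʳ a b≋b′ = ⊛-cong {a = a} (λ _ → refl) b≋b′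

  ⊛-suc : ∀ a b n → (a ⊛ b) (suc n) ≈ a 0 * b (suc n) + (shift a ⊛ b) n
  ⊛-suc a b n = sumUpTo-suc _ n

  0ₚ⊛ : ∀ b → 0ₚ ⊛ b ≋ 0ₚ
  0ₚ⊛ b n = sumUpTo-zero _ n (λ i _ → zeroˡ _)

  const⊛ : ∀ a b n → (const a ⊛ b) n ≈ a * b n
  const⊛ a b zero = refl
  const⊛ a b (suc n) = trans (⊛-suc (const a) b n) (trans (+-cong refl (0ₚ⊛ b n)) (+-identityʳ _))

  ⊛-identityˡ : ∀ b → one ⊛ b ≋ b
  ⊛-identityˡ b zero = *-identityˡ _
  ⊛-identityˡ b (suc n) = trans (⊛-suc one b n) (trans (+-cong (*-identityˡ _) (0ₚ⊛ b n)) (+-identityʳ _))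

  ⊛-comm : ∀ a b → a ⊛ b ≋ b ⊛ a
  ⊛-comm a b zero = *-comm _ _
  ⊛-comm a b (suc zero) = solve 4 (λ a₀ b₁ a₁ b₀ → a₀ :* b₁ :+ a₁ :* b₀ := b₀ :* a₁ :+ b₁ :* a₀) refl (a 0) (b 1) (a 1) (b 0)
  ⊛-comm a b (suc (suc n)) = begin
    (a ⊛ b) (2 ℕ.+ n)                                           ≈⟨ ⊛-suc a b (suc n) ⟩
    a 0 * b (2 ℕ.+ n) + (shift a ⊛ b) (suc n)                   ≈⟨ +-cong refl (⊛-comm (shift a) b (suc n)) ⟩
    a 0 * b (2 ℕ.+ n) + (b ⊛ shift a) (suc n)                   ≈⟨ +-cong refl (⊛-suc b (shift a) n) ⟩
    a 0 * b (2 ℕ.+ n) + (b 0 * a (2 ℕ.+ n) + (shift b ⊛ shift a) n) ≈⟨ +-cong refl (+-cong refl (⊛-comm (shift b) (shift a) n)) ⟩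
    a 0 * b (2 ℕ.+ n) + (b 0 * a (2 ℕ.+ n) + (shift a ⊛ shift b) n) ≈⟨ solve 3 (λ x y z → x :+ (y :+ z) := y :+ (x :+ z)) refl _ _ _ ⟩
    b 0 * a (2 ℕ.+ n) + (a 0 * b (2 ℕ.+ n) + (shift a ⊛ shift b) n) ≈⟨ +-cong refl (sym (⊛-suc a (shift b) n)) ⟩
    b 0 * a (2 ℕ.+ n) + (a ⊛ shift b) (suc n)                   ≈⟨ +-cong refl (⊛-comm a (shift b) (suc n)) ⟩
    b 0 * a (2 ℕ.+ n) + (shift b ⊛ a) (suc n)                   ≈⟨ sym (⊛-suc b a (suc n)) ⟩
    (b ⊛ a) (2 ℕ.+ n)                                           ∎
    where open ≈-Reasoning

  ⊛-distribʳ : ∀ d a b → (a +ₚ b) ⊛ d ≋ a ⊛ d +ₚ b ⊛ d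
  ⊛-distribʳ d a b n = trans (sumUpTo-cong n (λ i _ → distribʳ _ _ _)) (sumUpTo-+ _ _ n)

  ⊛-distribˡ : ∀ d a b → d ⊛ (a +ₚ b) ≋ d ⊛ a +ₚ d ⊛ b
  ⊛-distribˡ d a b n =
    trans (⊛-comm d (a +ₚ b) n) (trans (⊛-distribʳ d a b n) (+-cong (⊛-comm a d n) (⊛-comm b d n)))

  ⊛-*ˡ : ∀ k b d n → ((λ i → k * b i) ⊛ d) n ≈ k * (b ⊛ d) n
  ⊛-*ˡ k b d n = trans (sumUpTo-cong n (λ i _ → *-assoc _ _ _)) (sumUpTo-*ˡ k _ n)

  ⊛-assoc : ∀ a b d → (a ⊛ b) ⊛ d ≋ a ⊛ (b ⊛ d)
  ⊛-assoc a b d zero = *-assoc _ _ _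
  ⊛-assoc a b d (suc n) = begin
    ((a ⊛ b) ⊛ d) (suc n)                                                   ≈⟨ ⊛-suc (a ⊛ b) d n ⟩
    (a 0 * b 0) * d (suc n) + (shift (a ⊛ b) ⊛ d) n                         ≈⟨ +-cong refl (⊛-congˡ d (⊛-suc a b) n) ⟩
    (a 0 * b 0) * d (suc n) + (((λ i → a 0 * shift b i) +ₚ shift a ⊛ b) ⊛ d) n ≈⟨ +-cong refl (⊛-distribʳ d _ _ n) ⟩
    (a 0 * b 0) * d (suc n) + (((λ i → a 0 * shift b i) ⊛ d) n + ((shift a ⊛ b) ⊛ d) n)
      ≈⟨ +-cong refl (+-cong (⊛-*ˡ (a 0) (shift b) d n) (⊛-assoc (shift a) b d n)) ⟩
    (a 0 * b 0) * d (suc n) + (a 0 * (shift b ⊛ d) n + (shift a ⊛ (b ⊛ d)) n)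
      ≈⟨ solve 5 (λ x y z e f → (x :* y) :* z :+ (x :* e :+ f) := x :* (y :* z :+ e) :+ f) refl _ _ _ _ _ ⟩
    a 0 * (b 0 * d (suc n) + (shift b ⊛ d) n) + (shift a ⊛ (b ⊛ d)) n      ≈⟨ +-cong (*-cong refl (sym (⊛-suc b d n))) refl ⟩
    a 0 * (b ⊛ d) (suc n) + (shift a ⊛ (b ⊛ d)) n                           ≈⟨ sym (⊛-suc a (b ⊛ d) n) ⟩
    (a ⊛ (b ⊛ d)) (suc n)                                                   ∎
    where open ≈-Reasoning

  PSR : CommutativeRing c ℓ
  PSR = record
    { Carrier = PS ; _≈_ = _≋_ ; _+_ = _+ₚ_ ; _*_ = _⊛_ ; -_ = -ₚ_ ; 0# = 0ₚ ; 1# = one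
    ; isCommutativeRing = record
      { isRing = record
        { +-isAbelianGroup = record
          { isGroup = record
            { isMonoid = record
              { isSemigroup = record
                { isMagma = record
                  { isEquivalence = record
                    { refl = λ _ → refl ; sym = λ p n → sym (p n) ; trans = λ p q n → trans (p n) (q n) }
                  ; ∙-cong = λ p q n → +-cong (p n) (q n) }
                ; assoc = λ _ _ _ _ → +-assoc _ _ _ }
              ; identity = (λ _ _ → +-identityˡ _) , (λ _ _ → +-identityʳ _) }
            ; inverse = (λ _ _ → -‿inverseˡ _) , (λ _ _ → -‿inverseʳ _)
            ; ⁻¹-cong = λ p n → -‿cong (p n) }
          ; comm = λ _ _ _ → +-comm _ _ }
        ; *-cong = ⊛-cong ; *-assoc = ⊛-assoc
        ; *-identity = ⊛-identityˡ , (λ a n → trans (⊛-comm a one n) (⊛-identityˡ a n))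
        ; distrib = ⊛-distribˡ , ⊛-distribʳ }
      ; *-comm = ⊛-comm } }

  open CommutativeRing PSR public using ()
    renaming (refl to ≋-refl; sym to ≋-sym; trans to ≋-trans; +-cong to +ₚ-cong; *-identityʳ to ⊛-identityʳ)
  module ≋-Reasoning = SetoidReasoning (CommutativeRing.setoid PSR)
  open NaturalCoefficientSolver (CommutativeRing.commutativeSemiring PSR) public
    using () renaming (solve to solveₚ; _:=_ to _:=ₚ_; _:+_ to _:+ₚ_; _:*_ to _:*ₚ_; con to conₚ)

  X⊛-zero : ∀ a → (X ⊛ a) 0 ≈ 0#
  X⊛-zero a = zeroˡ _

  shift-X : shift X ≋ one
  shift-X zero = refl
  shift-X (suc n) = refl

  X⊛-suc : ∀ a n → (X ⊛ a) (suc n) ≈ a n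
  X⊛-suc a n = trans (⊛-suc X a n) (trans (+-cong (zeroˡ _) (⊛-congˡ a shift-X n)) (trans (+-identityˡ _) (⊛-identityˡ a n)))

  X⊛-cancel : ∀ {a b} → X ⊛ a ≋ X ⊛ b → a ≋ b
  X⊛-cancel {a} {b} Xa≋Xb n = trans (sym (X⊛-suc a n)) (trans (Xa≋Xb (suc n)) (X⊛-suc b n))

  ≋X⊛shift : ∀ a → a 0 ≈ 0# → a ≋ X ⊛ shift a
  ≋X⊛shift a a₀≈0 zero = trans a₀≈0 (sym (X⊛-zero (shift a)))
  ≋X⊛shift a a₀≈0 (suc n) = sym (X⊛-suc (shift a) n)

  pow-X⊛-+ : ∀ i s a → (pow X i ⊛ a) (i ℕ.+ s) ≈ a s
  pow-X⊛-+ zero s a = ⊛-identityˡ a s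
  pow-X⊛-+ (suc i) s a = trans (⊛-assoc X (pow X i) a (suc (i ℕ.+ s))) (trans (X⊛-suc (pow X i ⊛ a) (i ℕ.+ s)) (pow-X⊛-+ i s a))

  pow-X⊛-< : ∀ i a m → m < i → (pow X i ⊛ a) m ≈ 0#
  pow-X⊛-< (suc i) a zero _ = trans (⊛-assoc X (pow X i) a 0) (X⊛-zero (pow X i ⊛ a))
  pow-X⊛-< (suc i) a (suc m) (s≤s m<i) = trans (⊛-assoc X (pow X i) a (suc m)) (trans (X⊛-suc (pow X i ⊛ a) m) (pow-X⊛-< i a m m<i))

  const-cong : ∀ {a b} → a ≈ b → const a ≋ const b
  const-cong a≈b zero = a≈b
  const-cong a≈b (suc n) = refl

  const-0 : const 0# ≋ 0ₚ
  const-0 zero = refl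
  const-0 (suc n) = refl

  const-1 : const 1# ≋ one
  const-1 zero = refl
  const-1 (suc n) = refl

  const-+ : ∀ a b → const (a + b) ≋ const a +ₚ const b
  const-+ a b zero = refl
  const-+ a b (suc n) = sym (+-identityˡ _)

  const-* : ∀ a b → const (a * b) ≋ const a ⊛ const b
  const-* a b zero = refl
  const-* a b (suc n) = sym (trans (const⊛ a (const b) (suc n)) (zeroʳ _))

  pow-cong : ∀ {a b} k → a ≋ b → pow a k ≋ pow b k
  pow-cong zero _ = ≋-refl
  pow-cong (suc k) a≋b = ⊛-cong a≋b (pow-cong k a≋b)

  pow-+ : ∀ a i j → pow a (i ℕ.+ j) ≋ pow a i ⊛ pow a j
  pow-+ a zero j = ≋-sym (⊛-identityˡ _)
  pow-+ a (suc i) j = ≋-trans (⊛-congʳ a (pow-+ a i j)) (≋-sym (⊛-assoc a (pow a i) (pow a j)))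

  pow-⊛ : ∀ a b k → pow (a ⊛ b) k ≋ pow a k ⊛ pow b k
  pow-⊛ a b zero = ≋-sym (⊛-identityˡ one)
  pow-⊛ a b (suc k) = ≋-trans (⊛-congʳ (a ⊛ b) (pow-⊛ a b k))
    (solveₚ 4 (λ x y z w → (x :*ₚ y) :*ₚ (z :*ₚ w) :=ₚ (x :*ₚ z) :*ₚ (y :*ₚ w)) ≋-refl a b (pow a k) (pow b k))

  pow-one : ∀ k → pow one k ≋ one
  pow-one zero = ≋-refl
  pow-one (suc k) = ≋-trans (⊛-identityˡ _) (pow-one k)

  pow-inverse : ∀ {u y} → u ⊛ y ≋ one → ∀ k → pow u k ⊛ pow y k ≋ one
  pow-inverse uy≋1 k = ≋-trans (≋-sym (pow-⊛ _ _ k)) (≋-trans (pow-cong k uy≋1) (pow-one k))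

  nat-+ : ∀ m n → nat (m ℕ.+ n) ≈ nat m + nat n
  nat-+ zero n = sym (+-identityˡ _)
  nat-+ (suc m) n = trans (+-cong refl (nat-+ m n)) (sym (+-assoc _ _ _))

  deriv-cong : ∀ {a b} → a ≋ b → deriv a ≋ deriv b
  deriv-cong a≋b n = *-cong refl (a≋b (suc n))

  deriv-X : deriv X ≋ one
  deriv-X zero = trans (*-identityʳ _) (+-identityʳ _)
  deriv-X (suc n) = zeroʳ _

  deriv-one : deriv one ≋ 0ₚ
  deriv-one n = zeroʳ _

  -- Leibniz's rule is proved for the Euler operator x d/dx, which acts on coefficients as a ↦ n a.
  deriv-⊛ : ∀ a b → deriv (a ⊛ b) ≋ deriv a ⊛ b +ₚ a ⊛ deriv b
  deriv-⊛ a b = X⊛-cancel (≋-trans (X⊛deriv (a ⊛ b)) (≋-trans euler-⊛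
    (≋-trans (+ₚ-cong (⊛-congˡ b (≋-sym (X⊛deriv a))) (⊛-congʳ a (≋-sym (X⊛deriv b))))
      (solveₚ 5 (λ x da db a b → (x :*ₚ da) :*ₚ b :+ₚ a :*ₚ (x :*ₚ db) :=ₚ x :*ₚ (da :*ₚ b :+ₚ a :*ₚ db))
        ≋-refl X (deriv a) (deriv b) a b))))
    where
    euler : PS → PS
    euler a n = nat n * a n

    X⊛deriv : ∀ a → X ⊛ deriv a ≋ euler a
    X⊛deriv a zero = trans (X⊛-zero (deriv a)) (sym (zeroˡ _))
    X⊛deriv a (suc n) = X⊛-suc (deriv a) n

    euler-⊛ : euler (a ⊛ b) ≋ euler a ⊛ b +ₚ a ⊛ euler b
    euler-⊛ n = trans (sym (sumUpTo-*ˡ (nat n) _ n)) (trans (sumUpTo-cong n split) (sumUpTo-+ _ _ n))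
      where
      split : ∀ i → i ≤ n → nat n * (a i * b (n ∸ i)) ≈ (nat i * a i) * b (n ∸ i) + a i * (nat (n ∸ i) * b (n ∸ i))
      split i i≤n = trans (*-cong (trans (reflexive (≡.cong nat (≡.sym (ℕₚ.m+[n∸m]≡n i≤n)))) (nat-+ i (n ∸ i))) refl)
        (solve 4 (λ x y z w → (x :+ y) :* (z :* w) := (x :* z) :* w :+ z :* (y :* w)) refl _ _ _ _)

  deriv-pow : ∀ y r → deriv (pow y (suc r)) ≋ const (nat (suc r)) ⊛ (pow y r ⊛ deriv y)
  deriv-pow y zero = ≋-trans (deriv-⊛ y one) (≋-trans (+ₚ-cong ≋-refl (⊛-congʳ y deriv-one))
    (≋-trans (solveₚ 2 (λ dy y → dy :*ₚ conₚ 1 :+ₚ y :*ₚ conₚ 0 :=ₚ conₚ 1 :*ₚ (conₚ 1 :*ₚ dy)) ≋-refl (deriv y) y)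
      (⊛-congˡ (one ⊛ deriv y) (≋-sym (≋-trans (const-cong (+-identityʳ 1#)) const-1)))))
  deriv-pow y (suc r) = ≋-trans (deriv-⊛ y (pow y (suc r))) (≋-trans (+ₚ-cong ≋-refl (⊛-congʳ y (deriv-pow y r)))
    (≋-trans (solveₚ 4 (λ dy y p k → dy :*ₚ (y :*ₚ p) :+ₚ y :*ₚ (k :*ₚ (p :*ₚ dy)) :=ₚ (conₚ 1 :+ₚ k) :*ₚ ((y :*ₚ p) :*ₚ dy))
                ≋-refl (deriv y) y (pow y r) (const (nat (suc r))))
      (⊛-congˡ ((y ⊛ pow y r) ⊛ deriv y) (≋-sym (≋-trans (const-+ 1# (nat (suc r))) (+ₚ-cong const-1 ≋-refl))))))

  module Composition (φ : PS) (φ₀≈0 : φ 0 ≈ 0#) where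

    φ₀*≈0 : ∀ a → φ 0 * a ≈ 0#
    φ₀*≈0 a = trans (*-cong φ₀≈0 refl) (zeroˡ a)

    pow-vanishes : ∀ k m → m < k → pow φ k m ≈ 0#
    pow-vanishes (suc k) zero _ = φ₀*≈0 _
    pow-vanishes (suc k) (suc m) (s≤s m<k) = trans (⊛-suc φ (pow φ k) m) (trans (+-cong (φ₀*≈0 _)
      (sumUpTo-zero _ m (λ i _ → trans (*-cong refl (pow-vanishes k (m ∸ i) (ℕₚ.≤-<-trans (ℕₚ.m∸n≤m m i) m<k))) (zeroʳ _))))
      (+-identityˡ _))

    ∘ₚ-cong : ∀ {a b} → a ≋ b → a ∘ₚ φ ≋ b ∘ₚ φ
    ∘ₚ-cong a≋b n = sumUpTo-cong n (λ k _ → *-cong (a≋b k) refl)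

    ∘ₚ-+ : ∀ a b → (a +ₚ b) ∘ₚ φ ≋ a ∘ₚ φ +ₚ b ∘ₚ φ
    ∘ₚ-+ a b n = trans (sumUpTo-cong n (λ k _ → distribʳ _ _ _)) (sumUpTo-+ _ _ n)

    ∘ₚ-const⊛ : ∀ k a → (const k ⊛ a) ∘ₚ φ ≋ const k ⊛ (a ∘ₚ φ)
    ∘ₚ-const⊛ k a n = trans (sumUpTo-cong n (λ j _ → trans (*-cong (const⊛ k a j) refl) (*-assoc _ _ _)))
      (trans (sumUpTo-*ˡ k _ n) (sym (const⊛ k (a ∘ₚ φ) n)))

    ∘ₚ-horner : ∀ a → a ∘ₚ φ ≋ const (a 0) +ₚ φ ⊛ (shift a ∘ₚ φ)
    ∘ₚ-horner a zero = trans (*-identityʳ _) (sym (trans (+-cong refl (φ₀*≈0 _)) (+-identityʳ _)))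
    ∘ₚ-horner a (suc n) = begin
      (a ∘ₚ φ) (suc n)                                                      ≈⟨ sumUpTo-suc _ n ⟩
      a 0 * 0# + sumUpTo (λ k → a (suc k) * pow φ (suc k) (suc n)) n         ≈⟨ trans (+-cong (zeroʳ _) refl) (+-identityˡ _) ⟩
      sumUpTo (λ k → a (suc k) * pow φ (suc k) (suc n)) n
        ≈⟨ sumUpTo-cong n (λ k _ → *-cong refl (trans (⊛-suc φ (pow φ k) n) (trans (+-cong (φ₀*≈0 _) refl) (+-identityˡ _)))) ⟩
      sumUpTo (λ k → a (suc k) * (shift φ ⊛ pow φ k) n) n                   ≈⟨ sumUpTo-cong n (λ k _ → sym (sumUpTo-*ˡ _ _ n)) ⟩
      sumUpTo (λ k → sumUpTo (λ i → a (suc k) * (φ (suc i) * pow φ k (n ∸ i))) n) n ≈⟨ sumUpTo-swap _ n n ⟩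
      sumUpTo (λ i → sumUpTo (λ k → a (suc k) * (φ (suc i) * pow φ k (n ∸ i))) n) n ≈⟨ sumUpTo-cong n inner ⟩
      (shift φ ⊛ (shift a ∘ₚ φ)) n
        ≈⟨ sym (trans (+-identityˡ _) (trans (⊛-suc φ (shift a ∘ₚ φ) n) (trans (+-cong (φ₀*≈0 _) refl) (+-identityˡ _)))) ⟩
      (const (a 0) +ₚ φ ⊛ (shift a ∘ₚ φ)) (suc n)                           ∎
      where
      open ≈-Reasoning
      inner : ∀ i → i ≤ n → sumUpTo (λ k → a (suc k) * (φ (suc i) * pow φ k (n ∸ i))) n ≈ φ (suc i) * (shift a ∘ₚ φ) (n ∸ i)
      inner i _ = trans (sumUpTo-cong n (λ k _ → solve 3 (λ x y z → x :* (y :* z) := y :* (x :* z)) refl _ _ _))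
        (trans (sumUpTo-*ˡ _ _ n) (*-cong refl (sumUpTo-truncate _ (n ∸ i) n (ℕₚ.m∸n≤m n i)
          (λ k n∸i<k → trans (*-cong refl (pow-vanishes k (n ∸ i) n∸i<k)) (zeroʳ _)))))

    φ⊛-determined-below : ∀ n (a b : PS) → (∀ m → m < n → a m ≈ b m) → (φ ⊛ a) n ≈ (φ ⊛ b) n
    φ⊛-determined-below zero a b _ = trans (φ₀*≈0 _) (sym (φ₀*≈0 _))
    φ⊛-determined-below (suc n) a b a≈b = trans (⊛-suc φ a n) (trans (+-cong (trans (φ₀*≈0 _) (sym (φ₀*≈0 _)))
      (sumUpTo-cong n (λ i _ → *-cong refl (a≈b (n ∸ i) (s≤s (ℕₚ.m∸n≤m n i)))))) (sym (⊛-suc φ b n)))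

    -- By Horner's rule and strong induction on the degree: φ has no constant term, so the
    -- degree-n coefficient of φ ⊛ h only involves coefficients of h below n.
    ∘ₚ-⊛ : ∀ a b → (a ⊛ b) ∘ₚ φ ≋ (a ∘ₚ φ) ⊛ (b ∘ₚ φ)
    ∘ₚ-⊛ a b n = <-rec Multiplicative step n a b
      where
      Multiplicative : ℕ → Set (c ⊔ ℓ)
      Multiplicative n = ∀ a b → ((a ⊛ b) ∘ₚ φ) n ≈ ((a ∘ₚ φ) ⊛ (b ∘ₚ φ)) n

      step : ∀ n → (∀ {m} → m < n → Multiplicative m) → Multiplicative n
      step n IH a b = begin
        ((a ⊛ b) ∘ₚ φ) n                                                                       ≈⟨ ∘ₚ-horner (a ⊛ b) n ⟩
        (const ((a ⊛ b) 0) +ₚ φ ⊛ (shift (a ⊛ b) ∘ₚ φ)) n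
          ≈⟨ +-cong refl (φ⊛-determined-below n _ _ below) ⟩
        (const (a 0 * b 0) +ₚ φ ⊛ (const (a 0) ⊛ (shift b ∘ₚ φ) +ₚ (shift a ∘ₚ φ) ⊛ (b ∘ₚ φ))) n ≈⟨ expand n ⟩
        ((a ∘ₚ φ) ⊛ (b ∘ₚ φ)) n                                                                ∎
        where
        open ≈-Reasoning
        shift-⊛ : shift (a ⊛ b) ≋ const (a 0) ⊛ shift b +ₚ shift a ⊛ b
        shift-⊛ i = trans (⊛-suc a b i) (+-cong (sym (const⊛ (a 0) (shift b) i)) refl)
        below : ∀ m → m < n → (shift (a ⊛ b) ∘ₚ φ) m ≈ (const (a 0) ⊛ (shift b ∘ₚ φ) +ₚ (shift a ∘ₚ φ) ⊛ (b ∘ₚ φ)) m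
        below m m<n = trans (∘ₚ-cong shift-⊛ m) (trans (∘ₚ-+ _ _ m) (+-cong (∘ₚ-const⊛ (a 0) (shift b) m) (IH m<n (shift a) b)))
        expand : const (a 0 * b 0) +ₚ φ ⊛ (const (a 0) ⊛ (shift b ∘ₚ φ) +ₚ (shift a ∘ₚ φ) ⊛ (b ∘ₚ φ)) ≋ (a ∘ₚ φ) ⊛ (b ∘ₚ φ)
        expand = ≋-trans (+ₚ-cong (const-* (a 0) (b 0))
                                  (⊛-congʳ φ (+ₚ-cong (≋-refl {const (a 0) ⊛ (shift b ∘ₚ φ)}) (⊛-congʳ (shift a ∘ₚ φ) (∘ₚ-horner b)))))
          (≋-trans (solveₚ 5 (λ ca cb f sa sb → ca :*ₚ cb :+ₚ f :*ₚ (ca :*ₚ sb :+ₚ sa :*ₚ (cb :+ₚ f :*ₚ sb))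
                                                 :=ₚ (ca :+ₚ f :*ₚ sa) :*ₚ (cb :+ₚ f :*ₚ sb)) ≋-refl
                      (const (a 0)) (const (b 0)) φ (shift a ∘ₚ φ) (shift b ∘ₚ φ))
            (⊛-cong (≋-sym (∘ₚ-horner a)) (≋-sym (∘ₚ-horner b))))

    one∘ₚ : one ∘ₚ φ ≋ one
    one∘ₚ = ≋-trans (∘ₚ-horner one) (≋-trans (+ₚ-cong const-1 (⊛-congʳ φ shift-one∘ₚ))
      (solveₚ 1 (λ f → conₚ 1 :+ₚ f :*ₚ conₚ 0 :=ₚ conₚ 1) ≋-refl φ))
      where
      shift-one∘ₚ : shift one ∘ₚ φ ≋ 0ₚ
      shift-one∘ₚ n = sumUpTo-zero _ n (λ _ _ → zeroˡ _)

    X∘ₚ : X ∘ₚ φ ≋ φ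
    X∘ₚ = ≋-trans (∘ₚ-horner X) (≋-trans (+ₚ-cong const-0 (⊛-congʳ φ (≋-trans (∘ₚ-cong shift-X) one∘ₚ)))
      (solveₚ 1 (λ f → conₚ 0 :+ₚ f :*ₚ conₚ 1 :=ₚ f) ≋-refl φ))

    pow-∘ₚ : ∀ a k → pow a k ∘ₚ φ ≋ pow (a ∘ₚ φ) k
    pow-∘ₚ a zero = one∘ₚ
    pow-∘ₚ a (suc k) = ≋-trans (∘ₚ-⊛ a (pow a k)) (⊛-congʳ (a ∘ₚ φ) (pow-∘ₚ a k))

    ⊛∘ₚ-coeff : ∀ q b e → (q ⊛ (b ∘ₚ φ)) e ≈ sumUpTo (λ i → b i * (q ⊛ pow φ i) e) e
    ⊛∘ₚ-coeff q b e = begin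
      (q ⊛ (b ∘ₚ φ)) e
        ≈⟨ sumUpTo-cong e (λ l _ → *-cong refl (sym (sumUpTo-truncate _ (e ∸ l) e (ℕₚ.m∸n≤m e l)
             (λ k e∸l<k → trans (*-cong refl (pow-vanishes k (e ∸ l) e∸l<k)) (zeroʳ _))))) ⟩
      sumUpTo (λ l → q l * sumUpTo (λ i → b i * pow φ i (e ∸ l)) e) e   ≈⟨ sumUpTo-cong e (λ l _ → sym (sumUpTo-*ˡ _ _ e)) ⟩
      sumUpTo (λ l → sumUpTo (λ i → q l * (b i * pow φ i (e ∸ l))) e) e ≈⟨ sumUpTo-swap _ e e ⟩
      sumUpTo (λ i → sumUpTo (λ l → q l * (b i * pow φ i (e ∸ l))) e) e
        ≈⟨ sumUpTo-cong e (λ i _ → trans (sumUpTo-cong e (λ l _ → solve 3 (λ x y z → x :* (y :* z) := y :* (x :* z)) refl _ _ _))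
                                         (sumUpTo-*ˡ _ _ e)) ⟩
      sumUpTo (λ i → b i * (q ⊛ pow φ i) e) e                            ∎
      where open ≈-Reasoning

  -- With φ = x·u and y = 1/u, y^(r+1)·φ′ = x^(r+1)·φ′/φ^(r+1), so `residue r` says that φ′/φ^(r+1) has
  -- residue [r = 0]; for r ≥ 1 it is the derivative −(φ^(−r))′/r.
  module Residue (nat-cancel : ∀ r {a} → nat (suc r) * a ≈ 0# → a ≈ 0#)
                 (φ u y : PS) (φ≋X⊛u : φ ≋ X ⊛ u) (u⊛y≋1 : u ⊛ y ≋ one) where

    φ′ : PS
    φ′ = deriv φ

    deriv-φ : φ′ ≋ u +ₚ X ⊛ deriv u
    deriv-φ = ≋-trans (deriv-cong φ≋X⊛u)
      (≋-trans (deriv-⊛ X u) (+ₚ-cong (≋-trans (⊛-congˡ u deriv-X) (⊛-identityˡ u)) ≋-refl))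

    deriv-u⊛y : deriv y ⊛ u +ₚ y ⊛ deriv u ≋ 0ₚ
    deriv-u⊛y = ≋-trans (solveₚ 4 (λ u dy y du → dy :*ₚ u :+ₚ y :*ₚ du :=ₚ du :*ₚ y :+ₚ u :*ₚ dy) ≋-refl u (deriv y) y (deriv u))
      (≋-trans (≋-sym (deriv-⊛ u y)) (≋-trans (deriv-cong u⊛y≋1) deriv-one))

    pow-y⊛φ′ : ∀ r → pow y (suc r) ⊛ φ′ ≋ pow y r +ₚ X ⊛ (pow y (suc r) ⊛ deriv u)
    pow-y⊛φ′ r = begin
      pow y (suc r) ⊛ φ′                                   ≈⟨ ⊛-congʳ (pow y (suc r)) deriv-φ ⟩
      (y ⊛ pow y r) ⊛ (u +ₚ X ⊛ deriv u)
        ≈⟨ solveₚ 5 (λ y p u x du → (y :*ₚ p) :*ₚ (u :+ₚ x :*ₚ du) :=ₚ p :*ₚ (u :*ₚ y) :+ₚ x :*ₚ ((y :*ₚ p) :*ₚ du))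
             ≋-refl y (pow y r) u X (deriv u) ⟩
      pow y r ⊛ (u ⊛ y) +ₚ X ⊛ (pow y (suc r) ⊛ deriv u)
        ≈⟨ +ₚ-cong (≋-trans (⊛-congʳ (pow y r) u⊛y≋1) (⊛-identityʳ _)) ≋-refl ⟩
      pow y r +ₚ X ⊛ (pow y (suc r) ⊛ deriv u)             ∎
      where open ≋-Reasoning

    pow-y⊛deriv-y : ∀ r → pow y r ⊛ deriv y +ₚ pow y (2 ℕ.+ r) ⊛ deriv u ≋ 0ₚ
    pow-y⊛deriv-y r = begin
      pow y r ⊛ deriv y +ₚ (y ⊛ (y ⊛ pow y r)) ⊛ deriv u
        ≈⟨ +ₚ-cong (≋-sym (≋-trans (⊛-congʳ (pow y r ⊛ deriv y) u⊛y≋1) (⊛-identityʳ _))) ≋-refl ⟩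
      (pow y r ⊛ deriv y) ⊛ (u ⊛ y) +ₚ (y ⊛ (y ⊛ pow y r)) ⊛ deriv u
        ≈⟨ solveₚ 5 (λ p dy u y du → (p :*ₚ dy) :*ₚ (u :*ₚ y) :+ₚ (y :*ₚ (y :*ₚ p)) :*ₚ du
                                      :=ₚ (y :*ₚ p) :*ₚ (dy :*ₚ u :+ₚ y :*ₚ du))
             ≋-refl (pow y r) (deriv y) u y (deriv u) ⟩
      (y ⊛ pow y r) ⊛ (deriv y ⊛ u +ₚ y ⊛ deriv u)        ≈⟨ ⊛-congʳ (y ⊛ pow y r) deriv-u⊛y ⟩
      (y ⊛ pow y r) ⊛ 0ₚ                                  ≈⟨ solveₚ 1 (λ a → a :*ₚ conₚ 0 :=ₚ conₚ 0) ≋-refl (y ⊛ pow y r) ⟩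
      0ₚ                                                  ∎
      where open ≋-Reasoning

    residue : ∀ r → (pow y (suc r) ⊛ φ′) r ≈ one r
    residue zero = trans (pow-y⊛φ′ 0 0) (trans (+-cong refl (X⊛-zero (pow y 1 ⊛ deriv u))) (+-identityʳ _))
    residue (suc r) = nat-cancel r (begin
      nat (suc r) * (pow y (2 ℕ.+ r) ⊛ φ′) (suc r)
        ≈⟨ *-cong refl (trans (pow-y⊛φ′ (suc r) (suc r)) (+-cong refl (X⊛-suc W r))) ⟩
      nat (suc r) * (pow y (suc r) (suc r) + W r)                 ≈⟨ distribˡ _ _ _ ⟩
      nat (suc r) * pow y (suc r) (suc r) + nat (suc r) * W r
        ≈⟨ +-cong (trans (deriv-pow y r r) (const⊛ (nat (suc r)) (pow y r ⊛ deriv y) r)) refl ⟩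
      nat (suc r) * (pow y r ⊛ deriv y) r + nat (suc r) * W r     ≈⟨ sym (distribˡ _ _ _) ⟩
      nat (suc r) * ((pow y r ⊛ deriv y) r + W r)                 ≈⟨ *-cong refl (pow-y⊛deriv-y r r) ⟩
      nat (suc r) * 0#                                            ≈⟨ zeroʳ _ ⟩
      0#                                                          ∎)
      where
      open ≈-Reasoning
      W : PS
      W = pow y (2 ℕ.+ r) ⊛ deriv u

    φ₀≈0 : φ 0 ≈ 0#
    φ₀≈0 = trans (φ≋X⊛u 0) (X⊛-zero u)

    open Composition φ φ₀≈0

    pow-φ : ∀ i → pow φ i ≋ pow X i ⊛ pow u i
    pow-φ i = ≋-trans (pow-cong i φ≋X⊛u) (pow-⊛ X u i)

    ⊛pow-φ-coeff : ∀ q {i e} → i ≤ e → (q ⊛ pow φ i) e ≈ (q ⊛ pow u i) (e ∸ i)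
    ⊛pow-φ-coeff q {i} {e} i≤e = begin
      (q ⊛ pow φ i) e                          ≈⟨ ⊛-congʳ q (pow-φ i) e ⟩
      (q ⊛ (pow X i ⊛ pow u i)) e
        ≈⟨ solveₚ 3 (λ q x v → q :*ₚ (x :*ₚ v) :=ₚ x :*ₚ (q :*ₚ v)) ≋-refl q (pow X i) (pow u i) e ⟩
      (pow X i ⊛ (q ⊛ pow u i)) e              ≡⟨ ≡.cong (pow X i ⊛ (q ⊛ pow u i)) (≡.sym (ℕₚ.m+[n∸m]≡n i≤e)) ⟩
      (pow X i ⊛ (q ⊛ pow u i)) (i ℕ.+ (e ∸ i)) ≈⟨ pow-X⊛-+ i (e ∸ i) (q ⊛ pow u i) ⟩
      (q ⊛ pow u i) (e ∸ i)                    ∎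
      where open ≈-Reasoning

    pow-y⊛pow-u : ∀ {i n} → i ≤ n → pow y n ⊛ pow u i ≋ pow y (n ∸ i)
    pow-y⊛pow-u {i} {n} i≤n = begin
      pow y n ⊛ pow u i                     ≡⟨ ≡.cong (λ k → pow y k ⊛ pow u i) (≡.sym (ℕₚ.m∸n+n≡m i≤n)) ⟩
      pow y (n ∸ i ℕ.+ i) ⊛ pow u i         ≈⟨ ⊛-congˡ (pow u i) (pow-+ y (n ∸ i) i) ⟩
      (pow y (n ∸ i) ⊛ pow y i) ⊛ pow u i   ≈⟨ ⊛-assoc (pow y (n ∸ i)) (pow y i) (pow u i) ⟩
      pow y (n ∸ i) ⊛ (pow y i ⊛ pow u i)   ≈⟨ ⊛-congʳ (pow y (n ∸ i)) (≋-trans (⊛-comm _ _) (pow-inverse u⊛y≋1 i)) ⟩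
      pow y (n ∸ i) ⊛ one                   ≈⟨ ⊛-identityʳ _ ⟩
      pow y (n ∸ i)                         ∎
      where open ≋-Reasoning

    one-pos : ∀ {n} → 0 < n → one n ≈ 0#
    one-pos (s≤s _) = refl

    residue-pow-φ : ∀ {i e} → i ≤ e → ((φ′ ⊛ pow y (suc e)) ⊛ pow φ i) e ≈ one (e ∸ i)
    residue-pow-φ {i} {e} i≤e = begin
      ((φ′ ⊛ pow y (suc e)) ⊛ pow φ i) e        ≈⟨ ⊛pow-φ-coeff _ i≤e ⟩
      ((φ′ ⊛ pow y (suc e)) ⊛ pow u i) (e ∸ i)  ≈⟨ ⊛-assoc φ′ (pow y (suc e)) (pow u i) (e ∸ i) ⟩
      (φ′ ⊛ (pow y (suc e) ⊛ pow u i)) (e ∸ i)  ≈⟨ ⊛-congʳ φ′ (pow-y⊛pow-u (ℕₚ.m≤n⇒m≤1+n i≤e)) (e ∸ i) ⟩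
      (φ′ ⊛ pow y (suc e ∸ i)) (e ∸ i)          ≡⟨ ≡.cong (λ k → (φ′ ⊛ pow y k) (e ∸ i)) (ℕₚ.+-∸-assoc 1 i≤e) ⟩
      (φ′ ⊛ pow y (suc (e ∸ i))) (e ∸ i)        ≈⟨ ⊛-comm φ′ _ (e ∸ i) ⟩
      (pow y (suc (e ∸ i)) ⊛ φ′) (e ∸ i)        ≈⟨ residue (e ∸ i) ⟩
      one (e ∸ i)                               ∎
      where open ≈-Reasoning

    -- Lagrange inversion: if u = w(φ), i.e. φ = x·w(φ), then [xᵉ] (x φ′/φ) uᵐ = [xᵉ] wᵉ⁺ᵐ.
    module Lagrange (w : PS) (w∘ₚφ≋u : w ∘ₚ φ ≋ u) where

      φ′y⊛pow-u-as-composite : ∀ e m → (φ′ ⊛ y) ⊛ pow u m ≋ (φ′ ⊛ pow y (suc e)) ⊛ (pow w (e ℕ.+ m) ∘ₚ φ)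
      φ′y⊛pow-u-as-composite e m = ≋-sym (begin
        (φ′ ⊛ pow y (suc e)) ⊛ (pow w (e ℕ.+ m) ∘ₚ φ)
          ≈⟨ ⊛-congʳ _ (≋-trans (pow-∘ₚ w (e ℕ.+ m)) (pow-cong (e ℕ.+ m) w∘ₚφ≋u)) ⟩
        (φ′ ⊛ (y ⊛ pow y e)) ⊛ pow u (e ℕ.+ m)      ≈⟨ ⊛-congʳ _ (pow-+ u e m) ⟩
        (φ′ ⊛ (y ⊛ pow y e)) ⊛ (pow u e ⊛ pow u m)
          ≈⟨ solveₚ 5 (λ d y qe pe pm → (d :*ₚ (y :*ₚ qe)) :*ₚ (pe :*ₚ pm) :=ₚ ((d :*ₚ y) :*ₚ pm) :*ₚ (pe :*ₚ qe))
               ≋-refl φ′ y (pow y e) (pow u e) (pow u m) ⟩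
        ((φ′ ⊛ y) ⊛ pow u m) ⊛ (pow u e ⊛ pow y e) ≈⟨ ⊛-congʳ _ (pow-inverse u⊛y≋1 e) ⟩
        ((φ′ ⊛ y) ⊛ pow u m) ⊛ one                 ≈⟨ ⊛-identityʳ _ ⟩
        (φ′ ⊛ y) ⊛ pow u m                         ∎)
        where open ≋-Reasoning

      lagrange-coeff : ∀ e m → ((φ′ ⊛ y) ⊛ pow u m) e ≈ pow w (e ℕ.+ m) e
      lagrange-coeff e m = begin
        ((φ′ ⊛ y) ⊛ pow u m) e                    ≈⟨ φ′y⊛pow-u-as-composite e m e ⟩
        (q ⊛ (b ∘ₚ φ)) e                          ≈⟨ ⊛∘ₚ-coeff q b e ⟩
        sumUpTo (λ i → b i * (q ⊛ pow φ i) e) e   ≈⟨ sumUpTo-cong e (λ i i≤e → *-cong refl (residue-pow-φ i≤e)) ⟩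
        sumUpTo (λ i → b i * one (e ∸ i)) e
          ≈⟨ sumUpTo-last _ e (λ i i<e → trans (*-cong refl (one-pos (ℕₚ.m<n⇒0<n∸m i<e))) (zeroʳ _)) ⟩
        b e * one (e ∸ e)                         ≡⟨ ≡.cong (λ k → b e * one k) (ℕₚ.n∸n≡0 e) ⟩
        b e * 1#                                  ≈⟨ *-identityʳ _ ⟩
        b e                                       ∎
        where
        open ≈-Reasoning
        q b : PS
        q = φ′ ⊛ pow y (suc e)
        b = pow w (e ℕ.+ m)
      lagrange : ∀ b e m → (((φ′ ⊛ y) ⊛ pow u m) ⊛ (b ∘ₚ φ)) e ≈ (b ⊛ pow w (e ℕ.+ m)) e
      lagrange b e m = trans (⊛∘ₚ-coeff _ b e) (sumUpTo-cong e (λ i i≤e → *-cong refl (term i≤e)))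
        where
        term : ∀ {i} → i ≤ e → (((φ′ ⊛ y) ⊛ pow u m) ⊛ pow φ i) e ≈ pow w (e ℕ.+ m) (e ∸ i)
        term {i} i≤e = begin
          (((φ′ ⊛ y) ⊛ pow u m) ⊛ pow φ i) e         ≈⟨ ⊛pow-φ-coeff _ i≤e ⟩
          (((φ′ ⊛ y) ⊛ pow u m) ⊛ pow u i) (e ∸ i)   ≈⟨ merge (e ∸ i) ⟩
          ((φ′ ⊛ y) ⊛ pow u (i ℕ.+ m)) (e ∸ i)       ≈⟨ lagrange-coeff (e ∸ i) (i ℕ.+ m) ⟩
          pow w (e ∸ i ℕ.+ (i ℕ.+ m)) (e ∸ i)        ≡⟨ ≡.cong (λ k → pow w k (e ∸ i)) exponent ⟩
          pow w (e ℕ.+ m) (e ∸ i)                    ∎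
          where
          open ≈-Reasoning
          merge : ((φ′ ⊛ y) ⊛ pow u m) ⊛ pow u i ≋ (φ′ ⊛ y) ⊛ pow u (i ℕ.+ m)
          merge = ≋-trans (⊛-assoc (φ′ ⊛ y) (pow u m) (pow u i))
            (⊛-congʳ (φ′ ⊛ y) (≋-trans (⊛-comm (pow u m) (pow u i)) (≋-sym (pow-+ u i m))))
          exponent : e ∸ i ℕ.+ (i ℕ.+ m) ≡.≡ e ℕ.+ m
          exponent = ≡.trans (≡.sym (ℕₚ.+-assoc (e ∸ i) i m)) (≡.cong (ℕ._+ m) (ℕₚ.m∸n+n≡m i≤e))

  module Field (isField : IsField R) where

    ≈0-by-cancelʳ : ∀ {a b} → a * b ≈ 0# → ¬ (b ≈ 0#) → a ≈ 0#
    ≈0-by-cancelʳ {a} {b} ab≈0 b≉0 with proj₂ isField b b≉0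
    ... | b⁻¹ , bb⁻¹≈1 = begin
      a              ≈⟨ sym (*-identityʳ a) ⟩
      a * 1#         ≈⟨ *-cong refl (sym bb⁻¹≈1) ⟩
      a * (b * b⁻¹)  ≈⟨ sym (*-assoc _ _ _) ⟩
      (a * b) * b⁻¹  ≈⟨ trans (*-cong ab≈0 refl) (zeroˡ _) ⟩
      0#             ∎
      where open ≈-Reasoning

    *-nonzero : ∀ {a b} → ¬ (a ≈ 0#) → ¬ (b ≈ 0#) → ¬ (a * b ≈ 0#)
    *-nonzero a≉0 b≉0 ab≈0 = a≉0 (≈0-by-cancelʳ ab≈0 b≉0)

    unit-nonzeroˡ : ∀ {a b} → a * b ≈ 1# → ¬ (a ≈ 0#)
    unit-nonzeroˡ ab≈1 a≈0 = proj₁ isField (trans (sym ab≈1) (trans (*-cong a≈0 refl) (zeroˡ _)))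

    unit-nonzeroʳ : ∀ {a b} → a * b ≈ 1# → ¬ (b ≈ 0#)
    unit-nonzeroʳ ab≈1 b≈0 = proj₁ isField (trans (sym ab≈1) (trans (*-cong refl b≈0) (zeroʳ _)))

  module HorizontalHalf (isField : IsField R) (charZero : CharZero) (g f : PS) (riordan : IsRiordan g f)
                        (q : PS) (q⊛f≋X² : q ⊛ f ≋ X ⊛ X) (φ : PS) (rev : IsRev q φ)
                        (G₁ : PS) (G₁-def : G₁ ⊛ φ ≋ X ⊛ (deriv φ ⊛ (g ∘ₚ φ)))
                        (G₂ : PS) (G₂-def : G₂ ⊛ (f ∘ₚ φ) ≋ φ ⊛ (deriv φ ⊛ (g ∘ₚ φ))) where
    open Field isField
    open Composition φ (proj₁ rev)

    g₀≉0 : ¬ (g 0 ≈ 0#)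
    g₀≉0 = proj₁ riordan

    f₀≈0 : f 0 ≈ 0#
    f₀≈0 = proj₁ (proj₂ riordan)

    f₁≉0 : ¬ (f 1 ≈ 0#)
    f₁≉0 = proj₂ (proj₂ riordan)

    q₀≈0 : q 0 ≈ 0#
    q₀≈0 = ≈0-by-cancelʳ (begin
      q 0 * f 1            ≈⟨ sym (+-identityʳ _) ⟩
      q 0 * f 1 + 0#       ≈⟨ +-cong refl (sym (trans (*-cong refl f₀≈0) (zeroʳ _))) ⟩
      (q ⊛ f) 1            ≈⟨ q⊛f≋X² 1 ⟩
      (X ⊛ X) 1            ≈⟨ X⊛-suc X 0 ⟩
      0#                   ∎) f₁≉0
      where open ≈-Reasoning

    v w u y : PS
    v = shift q
    w = shift f
    u = shift φ
    y = v ∘ₚ φ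

    q≋X⊛v : q ≋ X ⊛ v
    q≋X⊛v = ≋X⊛shift q q₀≈0

    f≋X⊛w : f ≋ X ⊛ w
    f≋X⊛w = ≋X⊛shift f f₀≈0

    φ≋X⊛u : φ ≋ X ⊛ u
    φ≋X⊛u = ≋X⊛shift φ (proj₁ rev)

    v⊛w≋1 : v ⊛ w ≋ one
    v⊛w≋1 = X⊛-cancel (X⊛-cancel (begin
      X ⊛ (X ⊛ (v ⊛ w))     ≈⟨ solveₚ 3 (λ x v w → x :*ₚ (x :*ₚ (v :*ₚ w)) :=ₚ (x :*ₚ v) :*ₚ (x :*ₚ w)) ≋-refl X v w ⟩
      (X ⊛ v) ⊛ (X ⊛ w)     ≈⟨ ⊛-cong (≋-sym q≋X⊛v) (≋-sym f≋X⊛w) ⟩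
      q ⊛ f                 ≈⟨ q⊛f≋X² ⟩
      X ⊛ X                 ≈⟨ ⊛-congʳ X (≋-sym (⊛-identityʳ X)) ⟩
      X ⊛ (X ⊛ one)         ∎))
      where open ≋-Reasoning

    u⊛y≋1 : u ⊛ y ≋ one
    u⊛y≋1 = X⊛-cancel (begin
      X ⊛ (u ⊛ y)           ≈⟨ ≋-sym (⊛-assoc X u y) ⟩
      (X ⊛ u) ⊛ y           ≈⟨ ⊛-congˡ y (≋-sym (≋-trans X∘ₚ φ≋X⊛u)) ⟩
      (X ∘ₚ φ) ⊛ (v ∘ₚ φ)   ≈⟨ ≋-sym (∘ₚ-⊛ X v) ⟩
      (X ⊛ v) ∘ₚ φ          ≈⟨ ∘ₚ-cong (≋-sym q≋X⊛v) ⟩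
      q ∘ₚ φ                ≈⟨ proj₂ rev ⟩
      X                     ≈⟨ ≋-sym (⊛-identityʳ X) ⟩
      X ⊛ one               ∎)
      where open ≋-Reasoning

    w∘ₚφ≋u : w ∘ₚ φ ≋ u
    w∘ₚφ≋u = begin
      w ∘ₚ φ                ≈⟨ ≋-sym (≋-trans (⊛-congˡ (w ∘ₚ φ) u⊛y≋1) (⊛-identityˡ _)) ⟩
      (u ⊛ y) ⊛ (w ∘ₚ φ)    ≈⟨ ⊛-assoc u y (w ∘ₚ φ) ⟩
      u ⊛ (y ⊛ (w ∘ₚ φ))    ≈⟨ ⊛-congʳ u (≋-sym (∘ₚ-⊛ v w)) ⟩
      u ⊛ ((v ⊛ w) ∘ₚ φ)    ≈⟨ ⊛-congʳ u (≋-trans (∘ₚ-cong v⊛w≋1) one∘ₚ) ⟩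
      u ⊛ one               ≈⟨ ⊛-identityʳ u ⟩
      u                     ∎
      where open ≋-Reasoning

    fφ gφ : PS
    fφ = f ∘ₚ φ
    gφ = g ∘ₚ φ

    fφ≋X⊛u² : fφ ≋ X ⊛ (u ⊛ u)
    fφ≋X⊛u² = begin
      f ∘ₚ φ                ≈⟨ ∘ₚ-cong f≋X⊛w ⟩
      (X ⊛ w) ∘ₚ φ          ≈⟨ ∘ₚ-⊛ X w ⟩
      (X ∘ₚ φ) ⊛ (w ∘ₚ φ)   ≈⟨ ⊛-cong (≋-trans X∘ₚ φ≋X⊛u) w∘ₚφ≋u ⟩
      (X ⊛ u) ⊛ u           ≈⟨ ⊛-assoc X u u ⟩
      X ⊛ (u ⊛ u)           ∎
      where open ≋-Reasoning

    nat-cancel : ∀ r {a} → nat (suc r) * a ≈ 0# → a ≈ 0#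
    nat-cancel r na≈0 = ≈0-by-cancelʳ (trans (*-comm _ _) na≈0) (charZero r)

    open Residue nat-cancel φ u y φ≋X⊛u u⊛y≋1 using (φ′)
    open Residue.Lagrange nat-cancel φ u y φ≋X⊛u u⊛y≋1 w w∘ₚφ≋u using (lagrange)

    G₁≋φ′⊛gφ⊛y : G₁ ≋ (φ′ ⊛ gφ) ⊛ y
    G₁≋φ′⊛gφ⊛y = begin
      G₁                    ≈⟨ ≋-sym (≋-trans (⊛-congʳ G₁ u⊛y≋1) (⊛-identityʳ G₁)) ⟩
      G₁ ⊛ (u ⊛ y)          ≈⟨ ≋-sym (⊛-assoc G₁ u y) ⟩
      (G₁ ⊛ u) ⊛ y          ≈⟨ ⊛-congˡ y (X⊛-cancel X⊛G₁⊛u) ⟩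
      (φ′ ⊛ gφ) ⊛ y         ∎
      where
      open ≋-Reasoning
      X⊛G₁⊛u : X ⊛ (G₁ ⊛ u) ≋ X ⊛ (φ′ ⊛ gφ)
      X⊛G₁⊛u = ≋-trans (solveₚ 3 (λ x a b → x :*ₚ (a :*ₚ b) :=ₚ a :*ₚ (x :*ₚ b)) ≋-refl X G₁ u)
                       (≋-trans (⊛-congʳ G₁ (≋-sym φ≋X⊛u)) G₁-def)

    G₁≋G₂ : G₁ ≋ G₂
    G₁≋G₂ = ≋-sym (begin
      G₂
        ≈⟨ ≋-sym (≋-trans (⊛-congʳ G₂ (⊛-cong u⊛y≋1 u⊛y≋1)) (≋-trans (⊛-congʳ G₂ (⊛-identityʳ one)) (⊛-identityʳ G₂))) ⟩
      G₂ ⊛ ((u ⊛ y) ⊛ (u ⊛ y))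
        ≈⟨ solveₚ 3 (λ a u y → a :*ₚ ((u :*ₚ y) :*ₚ (u :*ₚ y)) :=ₚ ((a :*ₚ u) :*ₚ u) :*ₚ (y :*ₚ y)) ≋-refl G₂ u y ⟩
      ((G₂ ⊛ u) ⊛ u) ⊛ (y ⊛ y)           ≈⟨ ⊛-congˡ (y ⊛ y) (X⊛-cancel X⊛G₂⊛u²) ⟩
      (u ⊛ (φ′ ⊛ gφ)) ⊛ (y ⊛ y)
        ≈⟨ solveₚ 3 (λ u b y → (u :*ₚ b) :*ₚ (y :*ₚ y) :=ₚ (b :*ₚ y) :*ₚ (u :*ₚ y)) ≋-refl u (φ′ ⊛ gφ) y ⟩
      ((φ′ ⊛ gφ) ⊛ y) ⊛ (u ⊛ y)          ≈⟨ ≋-trans (⊛-congʳ _ u⊛y≋1) (⊛-identityʳ _) ⟩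
      (φ′ ⊛ gφ) ⊛ y                      ≈⟨ ≋-sym G₁≋φ′⊛gφ⊛y ⟩
      G₁                                 ∎)
      where
      open ≋-Reasoning
      X⊛G₂⊛u² : X ⊛ ((G₂ ⊛ u) ⊛ u) ≋ X ⊛ (u ⊛ (φ′ ⊛ gφ))
      X⊛G₂⊛u² = begin
        X ⊛ ((G₂ ⊛ u) ⊛ u)     ≈⟨ solveₚ 3 (λ x a b → x :*ₚ ((a :*ₚ b) :*ₚ b) :=ₚ a :*ₚ (x :*ₚ (b :*ₚ b))) ≋-refl X G₂ u ⟩
        G₂ ⊛ (X ⊛ (u ⊛ u))     ≈⟨ ⊛-congʳ G₂ (≋-sym fφ≋X⊛u²) ⟩
        G₂ ⊛ fφ                ≈⟨ G₂-def ⟩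
        φ ⊛ (φ′ ⊛ gφ)          ≈⟨ ⊛-congˡ (φ′ ⊛ gφ) φ≋X⊛u ⟩
        (X ⊛ u) ⊛ (φ′ ⊛ gφ)    ≈⟨ ⊛-assoc X u (φ′ ⊛ gφ) ⟩
        X ⊛ (u ⊛ (φ′ ⊛ gφ))    ∎

    isRiordan : IsRiordan G₁ fφ
    isRiordan = G₁₀≉0 , trans (*-cong f₀≈0 refl) (zeroˡ _) , fφ₁≉0
      where
      u₀≉0 : ¬ (u 0 ≈ 0#)
      u₀≉0 = unit-nonzeroˡ (u⊛y≋1 0)
      G₁₀≉0 : ¬ (G₁ 0 ≈ 0#)
      G₁₀≉0 G₁₀≈0 = *-nonzero (*-nonzero (*-nonzero (charZero 0) u₀≉0) (λ g₀1≈0 → g₀≉0 (trans (sym (*-identityʳ _)) g₀1≈0)))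
        (unit-nonzeroʳ (u⊛y≋1 0)) (trans (sym (G₁≋φ′⊛gφ⊛y 0)) G₁₀≈0)
      fφ₁≉0 : ¬ (fφ 1 ≈ 0#)
      fφ₁≉0 fφ₁≈0 = *-nonzero u₀≉0 u₀≉0 (trans (sym (X⊛-suc (u ⊛ u) 0)) (trans (sym (fφ≋X⊛u² 1)) fφ₁≈0))

    g⊛pow-f : ∀ N → g ⊛ pow f N ≋ pow X N ⊛ (g ⊛ pow w N)
    g⊛pow-f N = ≋-trans (⊛-congʳ g (≋-trans (pow-cong N f≋X⊛w) (pow-⊛ X w N)))
      (solveₚ 3 (λ a b c → a :*ₚ (b :*ₚ c) :=ₚ b :*ₚ (a :*ₚ c)) ≋-refl g (pow X N) (pow w N))

    G₁⊛pow-fφ : ∀ k → G₁ ⊛ pow fφ k ≋ pow X k ⊛ (((φ′ ⊛ y) ⊛ pow u (k ℕ.+ k)) ⊛ gφ)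
    G₁⊛pow-fφ k = ≋-trans (⊛-cong G₁≋φ′⊛gφ⊛y (≋-trans (pow-cong k fφ≋X⊛u²) (pow-⊛ X (u ⊛ u) k)))
      (≋-trans (solveₚ 5 (λ d g y x p → ((d :*ₚ g) :*ₚ y) :*ₚ (x :*ₚ p) :=ₚ x :*ₚ (((d :*ₚ y) :*ₚ p) :*ₚ g))
                  ≋-refl φ′ gφ y (pow X k) (pow (u ⊛ u) k))
        (⊛-congʳ (pow X k) (⊛-congˡ gφ (⊛-congʳ (φ′ ⊛ y) (≋-trans (pow-⊛ u u k) (≋-sym (pow-+ u k k)))))))

    entry-diagonal : ∀ k d → riordanEntry g f (2 ℕ.* (k ℕ.+ d)) (k ℕ.+ d ℕ.+ k) ≈ riordanEntry G₁ fφ (k ℕ.+ d) k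
    entry-diagonal k d = begin
      (g ⊛ pow f N) (2 ℕ.* (k ℕ.+ d))              ≈⟨ g⊛pow-f N (2 ℕ.* (k ℕ.+ d)) ⟩
      (pow X N ⊛ (g ⊛ pow w N)) (2 ℕ.* (k ℕ.+ d))  ≡⟨ ≡.cong (pow X N ⊛ (g ⊛ pow w N)) (row k d) ⟩
      (pow X N ⊛ (g ⊛ pow w N)) (N ℕ.+ d)          ≈⟨ pow-X⊛-+ N d (g ⊛ pow w N) ⟩
      (g ⊛ pow w N) d                              ≡⟨ ≡.cong (λ j → (g ⊛ pow w j) d) (column k d) ⟩
      (g ⊛ pow w (d ℕ.+ (k ℕ.+ k))) d              ≈⟨ sym (lagrange g d (k ℕ.+ k)) ⟩
      (P ⊛ gφ) d                                   ≈⟨ sym (pow-X⊛-+ k d (P ⊛ gφ)) ⟩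
      (pow X k ⊛ (P ⊛ gφ)) (k ℕ.+ d)               ≈⟨ sym (G₁⊛pow-fφ k (k ℕ.+ d)) ⟩
      (G₁ ⊛ pow fφ k) (k ℕ.+ d)                    ∎
      where
      open ≈-Reasoning
      N : ℕ
      N = k ℕ.+ d ℕ.+ k
      P : PS
      P = (φ′ ⊛ y) ⊛ pow u (k ℕ.+ k)
      row : ∀ k d → 2 ℕ.* (k ℕ.+ d) ≡.≡ k ℕ.+ d ℕ.+ k ℕ.+ d
      row = solve-∀
      column : ∀ k d → k ℕ.+ d ℕ.+ k ≡.≡ d ℕ.+ (k ℕ.+ k)
      column = solve-∀

    entry-above-diagonal : ∀ {n k} → n < k → riordanEntry g f (2 ℕ.* n) (n ℕ.+ k) ≈ riordanEntry G₁ fφ n k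
    entry-above-diagonal {n} {k} n<k = trans (g⊛pow-f (n ℕ.+ k) (2 ℕ.* n))
      (trans (pow-X⊛-< (n ℕ.+ k) (g ⊛ pow w (n ℕ.+ k)) (2 ℕ.* n) 2n<n+k)
        (sym (trans (G₁⊛pow-fφ k n) (pow-X⊛-< k (((φ′ ⊛ y) ⊛ pow u (k ℕ.+ k)) ⊛ gφ) n n<k))))
      where
      2n<n+k : 2 ℕ.* n < n ℕ.+ k
      2n<n+k = ℕₚ.+-monoʳ-< n (≡.subst (_< k) (≡.sym (ℕₚ.+-identityʳ n)) n<k)

    entries : ∀ n k → riordanEntry g f (2 ℕ.* n) (n ℕ.+ k) ≈ riordanEntry G₁ fφ n k
    entries n k with k ≤? n
    ... | yes k≤n = ≡.subst (λ n → riordanEntry g f (2 ℕ.* n) (n ℕ.+ k) ≈ riordanEntry G₁ fφ n k)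
                            (ℕₚ.m+[n∸m]≡n k≤n) (entry-diagonal k (n ∸ k))
    ... | no k≰n = entry-above-diagonal (ℕₚ.≰⇒> k≰n)

open import Data.Nat using (_+_; _*_)

mainTheorem2 : ∀ {c ℓ : Level} (R : CommutativeRing c ℓ) → IsField R →
    let open FPS R in
    CharZero →
    (g f : PS) → IsRiordan g f →
    -- q = x² / f(x)
    (q : PS) → q ⊛ f ≋ X ⊛ X →
    -- φ = Rev(x² / f(x))
    (φ : PS) → IsRev q φ →
    -- G₁ = x φ'(x) g(φ(x)) / φ(x)
    (G₁ : PS) → G₁ ⊛ φ ≋ X ⊛ (deriv φ ⊛ (g ∘ₚ φ)) →
    -- G₂ = φ(x) φ'(x) g(φ(x)) / f(φ(x))
    (G₂ : PS) → G₂ ⊛ (f ∘ₚ φ) ≋ φ ⊛ (deriv φ ⊛ (g ∘ₚ φ)) →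
    IsRiordan G₁ (f ∘ₚ φ)
    × (∀ (n k : ℕ) → riordanEntry g f (2 * n) (n + k) ≈ riordanEntry G₁ (f ∘ₚ φ) n k)
    × G₁ ≋ G₂
mainTheorem2 R isField charZero g f riordan q q⊛f≋X² φ rev G₁ G₁-def G₂ G₂-def =
  isRiordan , entries , G₁≋G₂
  where open Series.HorizontalHalf R isField charZero g f riordan q q⊛f≋X² φ rev G₁ G₁-def G₂ G₂-def
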